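{- (Expansion of unity) Let $S$ be a solid and let $x\in S$ with $x\ne e(x)$. Then $u(x)=1+e(u(x))$.
   Context: A solid is a set $S$ with binary operations $+$ and $\cdot$ and a relation $\le$ satisfying: (1) $+$ is associative and commutative; for every $x$ there is a unique $e$ with $x+e=x$ and $e+f=e$ whenever $x+f=x$, written $e(x)$ (the magnitude of $x$); for every $x$ there is $s$ with $x+s=e(x)$ and $e(s)=e(x)$, written $-x$; $e(x+y)=e(x)$ or $e(x+y)=e(y)$. (2) $\cdot$ is associative and commutative; for every $x\ne e(x)$ there is a unique $u$ with $xu=x$ and $uv=u$ whenever $xv=x$, written $u(x)$; for every $x\ne e(x)$ there is $d$ with $xd=u(x)$ and $u(d)=u(x)$, written $x^{ -1}$; for $x\ne e(x),y\ne e(y)$: $u(xy)=u(x)$ or $u(xy)=u(y)$. (3) $\le$ is a total order; $x\le y\Rightarrow x+z\le y+z$; $y+e(x)=e(x)\Rightarrow (y\le e(x)$ and $-y\le e(x))$; $(e(x)<x$ and $y\le z)\Rightarrow xy\le xz$; $e(y)\le y\le z\Rightarrow e(x)y\le e(x)z$. (4) For all $x,y$ there is $z$ with $e(x)y=e(z)$; $e(xy)=e(x)y+e(y)x$; for $x\ne e(x)$, $e(u(x))=e(x)x^{ -1}$; $xy+xz=x(y+z)+e(x)y+e(x)z$; $-(xy)=(-x)y$. (5) There is $0$ with $0+x=x$ for all $x$; there is $1$ with $1x=x$ for all $x$ (it is unique, called one); there is $M$ with $e(x)+M=M$ for all $x$; there is $x$ with $e(x)\ne 0$ and $e(x)\ne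 M$; for every $x$ there is $a$ with $x=a+e(x)$ and $e(a)=0$; if $x=e(x)$, $y=e(y)$ and $x<y$ then there is $z\ne e(z)$ with $x<z<y$. -}

module Defs where

open import Level using (Level; suc; _⊔_)
open import Data.Product using (Σ; _×_; ∃; ∃-syntax)
open import Data.Sum using (_⊎_)
open import Relation.Binary.PropositionalEquality using (_≡_; _≢_)
open import Relation.Binary.Structures using (IsTotalOrder)

-- The operations e (magnitude), -_ (a chosen
-- negative), u (unity) and _⁻¹ (a chosen inverse) are given as (Skolem)
-- functions together with exactly the properties the axioms demand.
-- u and _⁻¹ are total functions, but their properties are only required
-- for x ≢ e x (their values elsewhere are irrelevant junk).
record Solid (c ℓ : Level) : Set (suc (c ⊔ ℓ)) where
  infixl 6 _+_
  infixl 7 _·_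
  infix 4 _≤_ _<_
  field
    Carrier : Set c
    _+_ _·_ : Carrier → Carrier → Carrier
    _≤_     : Carrier → Carrier → Set ℓ
    e       : Carrier → Carrier
    -_      : Carrier → Carrier
    u       : Carrier → Carrier
    _⁻¹     : Carrier → Carrier
    zero one M : Carrier

  _<_ : Carrier → Carrier → Set (c ⊔ ℓ)
  x < y = (x ≤ y) × (x ≢ y)

  field
    +-assoc : ∀ x y z → (x + y) + z ≡ x + (y + z)
    +-comm  : ∀ x y → x + y ≡ y + x
    e-neutral : ∀ x → x + e x ≡ x
    e-least   : ∀ x f → x + f ≡ x → e x + f ≡ e x
    e-unique  : ∀ x e′ → x + e′ ≡ x → (∀ f → x + f ≡ x → e′ + f ≡ e′) → e′ ≡ e x
    neg-inv   : ∀ x → x + (- x) ≡ e x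
    neg-e     : ∀ x → e (- x) ≡ e x
    e-+       : ∀ x y → (e (x + y) ≡ e x) ⊎ (e (x + y) ≡ e y)
    ·-assoc : ∀ x y z → (x · y) · z ≡ x · (y · z)
    ·-comm  : ∀ x y → x · y ≡ y · x
    u-neutral : ∀ x → x ≢ e x → x · u x ≡ x
    u-least   : ∀ x → x ≢ e x → ∀ v → x · v ≡ x → u x · v ≡ u x
    u-unique  : ∀ x → x ≢ e x → ∀ u′ → x · u′ ≡ x → (∀ v → x · v ≡ x → u′ · v ≡ u′) → u′ ≡ u x
    inv-inv   : ∀ x → x ≢ e x → x · (x ⁻¹) ≡ u x
    inv-u     : ∀ x → x ≢ e x → u (x ⁻¹) ≡ u x
    u-·       : ∀ x y → x ≢ e x → y ≢ e y → (u (x · y) ≡ u x) ⊎ (u (x · y) ≡ u y)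
    ≤-isTotalOrder : IsTotalOrder _≡_ _≤_
    +-mono-≤  : ∀ x y z → x ≤ y → x + z ≤ y + z
    e-absorb-≤ : ∀ x y → y + e x ≡ e x → (y ≤ e x) × (- y ≤ e x)
    ·-mono-pos : ∀ x y z → e x < x → y ≤ z → x · y ≤ x · z
    ·-mono-e   : ∀ x y z → e y ≤ y → y ≤ z → e x · y ≤ e x · z
    e-·-is-e   : ∀ x y → ∃[ z ] (e x · y ≡ e z)
    e-·        : ∀ x y → e (x · y) ≡ e x · y + e y · x
    e-u        : ∀ x → x ≢ e x → e (u x) ≡ e x · (x ⁻¹)
    distrib    : ∀ x y z → x · y + x · z ≡ x · (y + z) + e x · y + e x · z
    neg-·      : ∀ x y → - (x · y) ≡ (- x) · y
    zero-id    : ∀ x → zero + x ≡ x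
    one-id     : ∀ x → one · x ≡ x
    M-absorb   : ∀ x → e x + M ≡ M
    nontrivial : ∃[ x ] ((e x ≢ zero) × (e x ≢ M))
    decompose  : ∀ x → ∃[ a ] ((x ≡ a + e x) × (e a ≡ zero))
    dense      : ∀ x y → x ≡ e x → y ≡ e y → x < y → ∃[ z ] ((z ≢ e z) × (x < z) × (z < y))

-- The unity t = u(x) is an idempotent that is not a magnitude; write N = e(t) and
-- d = 1 - t.  Up to adding N, d is the idempotent complementary to t: t·d + N = N,
-- d·d + N = d and e(d) = N.  The order then forces d = N.  If d ≤ N, then -d ≥ N, and
-- multiplying by the positive element t - d gives N ≤ (t - d)·(-d) + N = d² + N = d.  If N ≤ d, then
-- t ≤ d is impossible (t = t² ≤ t·d ≤ N), and d ≤ t makes t - d positive, so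
-- N ≤ (t - d)·d + N = -d² + N, whence d = d² + N ≤ N.  Hence t = t + N = t + d = 1 + N.
module Submission where

open import Algebra.Bundles using (CommutativeSemigroup)
import Algebra.Properties.CommutativeSemigroup as CommutativeSemigroupProperties
open import Data.Empty using (⊥-elim)
open import Data.Product using (_,_; proj₁)
open import Data.Sum using (_⊎_; inj₁; inj₂; [_,_]′; reduce)
import Data.Sum as Sum
open import Defs
open import Level using (Level)
open import Relation.Binary.PropositionalEquality
  using (_≡_; _≢_; refl; sym; trans; cong; cong₂; subst; subst₂; isEquivalence; module ≡-Reasoning)
open import Relation.Binary.Structures using (IsTotalOrder)
open import Relation.Nullary using (¬_)

module SolidProperties {c ℓ : Level} (S : Solid c ℓ) where
  open Solid S
  open IsTotalOrder ≤-isTotalOrder using (total; antisym) renaming (trans to ≤-trans)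
  open ≡-Reasoning

  +-commutativeSemigroup : CommutativeSemigroup c c
  +-commutativeSemigroup = record
    { isCommutativeSemigroup = record
      { isSemigroup = record
        { isMagma = record { isEquivalence = isEquivalence ; ∙-cong = cong₂ _+_ }
        ; assoc   = +-assoc
        }
      ; comm = +-comm
      }
    }

  open CommutativeSemigroupProperties +-commutativeSemigroup using (interchange)

  ≤-resp-≡ : ∀ {a a′ b b′} → a ≡ a′ → b ≡ b′ → a ≤ b → a′ ≤ b′
  ≤-resp-≡ = subst₂ _≤_

  +-identityʳ : ∀ y → y + zero ≡ y
  +-identityʳ y = trans (+-comm y zero) (zero-id y)

  ·-identityʳ : ∀ y → y · one ≡ y
  ·-identityʳ y = trans (·-comm y one) (one-id y)

  +-absorbed : ∀ {p} a b → b + p ≡ p → a + b + p ≡ a + p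
  +-absorbed {p} a b b+p≡p = trans (+-assoc a b p) (cong (a +_) b+p≡p)

  IsMagnitude : Carrier → Set c
  IsMagnitude p = e p ≡ p

  e+e≡e : ∀ y → e y + e y ≡ e y
  e+e≡e y = e-least y (e y) (e-neutral y)

  +-idem⇒magnitude : ∀ y → y + y ≡ y → IsMagnitude y
  +-idem⇒magnitude y y+y≡y = sym (e-unique y y y+y≡y (λ _ y+f≡y → y+f≡y))

  magnitude⇒+-idem : ∀ {p} → IsMagnitude p → p + p ≡ p
  magnitude⇒+-idem {p} ep≡p = subst (λ q → q + q ≡ q) ep≡p (e+e≡e p)

  e-isMagnitude : ∀ y → IsMagnitude (e y)
  e-isMagnitude y = +-idem⇒magnitude (e y) (e+e≡e y)

  e·-isMagnitude : ∀ a b → IsMagnitude (e a · b)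
  e·-isMagnitude a b with e-·-is-e a b
  ... | z , ea·b≡ez = trans (cong e ea·b≡ez) (trans (e-isMagnitude z) (sym ea·b≡ez))

  ≡magnitude⇒≡e : ∀ {y p} → y ≡ p → IsMagnitude p → y ≡ e y
  ≡magnitude⇒≡e y≡p ep≡p = trans y≡p (sym (trans (cong e y≡p) ep≡p))

  magnitude-+-selective : ∀ {p q} → IsMagnitude p → IsMagnitude q → (p + q ≡ p) ⊎ (p + q ≡ q)
  magnitude-+-selective {p} {q} ep≡p eq≡q =
    Sum.map (λ h → trans p+q≡e[p+q] (trans h ep≡p)) (λ h → trans p+q≡e[p+q] (trans h eq≡q)) (e-+ p q)
    where
      p+q≡e[p+q] : p + q ≡ e (p + q)
      p+q≡e[p+q] = sym (+-idem⇒magnitude (p + q)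
        (trans (interchange p q p q) (cong₂ _+_ (magnitude⇒+-idem ep≡p) (magnitude⇒+-idem eq≡q))))

  absorbed⇒e-absorbed : ∀ {p} y → IsMagnitude p → y + p ≡ p → e y + p ≡ p
  absorbed⇒e-absorbed {p} y ep≡p y+p≡p with magnitude-+-selective (e-isMagnitude y) ep≡p
  ... | inj₂ ey+p≡p = ey+p≡p
  ... | inj₁ ey+p≡ey = begin
    e y + p   ≡⟨ cong (λ z → e z + p) y≡p ⟩
    e p + p   ≡⟨ cong (_+ p) ep≡p ⟩
    p + p     ≡⟨ magnitude⇒+-idem ep≡p ⟩
    p         ∎
    where
      y≡p : y ≡ p
      y≡p = begin
        y             ≡⟨ sym (e-neutral y) ⟩
        y + e y       ≡⟨ cong (y +_) (sym ey+p≡ey) ⟩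
        y + (e y + p) ≡⟨ sym (+-assoc y (e y) p) ⟩
        y + e y + p   ≡⟨ cong (_+ p) (e-neutral y) ⟩
        y + p         ≡⟨ y+p≡p ⟩
        p             ∎

  absorbed⇒neg-absorbed : ∀ {p} y → IsMagnitude p → y + p ≡ p → (- y) + p ≡ p
  absorbed⇒neg-absorbed {p} y ep≡p y+p≡p = begin
    (- y) + p         ≡⟨ cong ((- y) +_) (sym y+p≡p) ⟩
    (- y) + (y + p)   ≡⟨ sym (+-assoc (- y) y p) ⟩
    (- y) + y + p     ≡⟨ cong (_+ p) (trans (+-comm (- y) y) (neg-inv y)) ⟩
    e y + p           ≡⟨ absorbed⇒e-absorbed y ep≡p y+p≡p ⟩
    p                 ∎

  neg+e≡neg : ∀ y → (- y) + e y ≡ - y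
  neg+e≡neg y = trans (cong ((- y) +_) (sym (neg-e y))) (e-neutral (- y))

  neg-magnitude : ∀ {p} → IsMagnitude p → - p ≡ p
  neg-magnitude {p} ep≡p = begin
    - p       ≡⟨ sym (neg+e≡neg p) ⟩
    (- p) + e p ≡⟨ +-comm (- p) (e p) ⟩
    e p + (- p) ≡⟨ cong (_+ (- p)) ep≡p ⟩
    p + (- p) ≡⟨ neg-inv p ⟩
    e p       ≡⟨ ep≡p ⟩
    p         ∎

  neg-involutive : ∀ y → - (- y) ≡ y
  neg-involutive y = begin
    - (- y)                   ≡⟨ sym (neg+e≡neg (- y)) ⟩
    (- (- y)) + e (- y)       ≡⟨ cong ((- (- y)) +_) (trans (neg-e y) (sym (neg-inv y))) ⟩
    (- (- y)) + (y + (- y))   ≡⟨ +-comm (- (- y)) (y + (- y)) ⟩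
    y + (- y) + (- (- y))     ≡⟨ +-assoc y (- y) (- (- y)) ⟩
    y + ((- y) + (- (- y)))   ≡⟨ cong (y +_) (trans (neg-inv (- y)) (neg-e y)) ⟩
    y + e y                   ≡⟨ e-neutral y ⟩
    y                         ∎

  neg-distribʳ-· : ∀ a b → - (a · b) ≡ a · (- b)
  neg-distribʳ-· a b = trans (cong -_ (·-comm a b)) (trans (neg-· b a) (·-comm (- b) a))

  neg-·-neg : ∀ a b → (- a) · (- b) ≡ a · b
  neg-·-neg a b = begin
    (- a) · (- b)   ≡⟨ sym (neg-· a (- b)) ⟩
    - (a · (- b))   ≡⟨ cong -_ (sym (neg-distribʳ-· a b)) ⟩
    - (- (a · b))   ≡⟨ neg-involutive (a · b) ⟩
    a · b           ∎

  distrib-absorbed : ∀ {p} a b c → e a · b + p ≡ p → e a · c + p ≡ p →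
                     a · b + a · c + p ≡ a · (b + c) + p
  distrib-absorbed {p} a b c ea·b+p≡p ea·c+p≡p = begin
    a · b + a · c + p                       ≡⟨ cong (_+ p) (distrib a b c) ⟩
    a · (b + c) + e a · b + e a · c + p     ≡⟨ +-absorbed (a · (b + c) + e a · b) (e a · c) ea·c+p≡p ⟩
    a · (b + c) + e a · b + p               ≡⟨ +-absorbed (a · (b + c)) (e a · b) ea·b+p≡p ⟩
    a · (b + c) + p                         ∎

  idempotent⇒e·≡e : ∀ y → y · y ≡ y → e y · y ≡ e y
  idempotent⇒e·≡e y y·y≡y = sym (begin
    e y               ≡⟨ cong e (sym y·y≡y) ⟩
    e (y · y)         ≡⟨ e-· y y ⟩
    e y · y + e y · y ≡⟨ magnitude⇒+-idem (e·-isMagnitude y y) ⟩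
    e y · y           ∎)

  idempotent⇒e≤ : ∀ y → y · y ≡ y → y ≢ e y → e y ≤ y
  idempotent⇒e≤ y y·y≡y y≢ey with total (e y) y
  ... | inj₁ ey≤y = ey≤y
  ... | inj₂ y≤ey = ⊥-elim (ey≢-y (antisym ey≤-y -y≤ey))
    where
      ey≤-y : e y ≤ - y
      ey≤-y = ≤-resp-≡ (neg-inv y) (trans (+-comm (e y) (- y)) (neg+e≡neg y)) (+-mono-≤ y (e y) (- y) y≤ey)

      ey≢-y : e y ≢ - y
      ey≢-y ey≡-y = y≢ey (begin
        y         ≡⟨ sym (neg-involutive y) ⟩
        - (- y)   ≡⟨ cong -_ (sym ey≡-y) ⟩
        - (e y)   ≡⟨ neg-magnitude (e-isMagnitude y) ⟩
        e y       ∎)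

      -y-positive : e (- y) < - y
      -y-positive = subst (_≤ - y) (sym (neg-e y)) ey≤-y
                  , λ e[-y]≡-y → ey≢-y (trans (sym (neg-e y)) e[-y]≡-y)

      -y≤ey : - y ≤ e y
      -y≤ey = ≤-resp-≡ (trans (sym (neg-· y y)) (cong -_ y·y≡y))
                       (trans (sym (neg-· y (e y)))
                         (trans (cong -_ (trans (·-comm y (e y)) (idempotent⇒e·≡e y y·y≡y)))
                                (neg-magnitude (e-isMagnitude y))))
                       (·-mono-pos (- y) y (e y) -y-positive y≤ey)

  one≢e-one : ∀ y → y ≢ e y → one ≢ e one
  one≢e-one y y≢ey one≡e-one =
    y≢ey (≡magnitude⇒≡e (trans (sym (one-id y)) (cong (_· y) one≡e-one)) (e·-isMagnitude one y))

  -- With one = a + e one and e a = zero, we get one ≤ a + a; multiplying by the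
  -- magnitude e one yields e one ≤ e one · (a + a) = e (a + a) = zero.
  e-one≡zero : one ≢ e one → e one ≡ zero
  e-one≡zero one≢e-one with decompose one
  ... | a , one≡a+e-one , ea≡zero = antisym e-one≤zero zero≤e-one
    where
      m = e one

      m≤one : m ≤ one
      m≤one = idempotent⇒e≤ one (one-id one) one≢e-one

      m≤a : m ≤ a
      m≤a with total a m
      ... | inj₂ m≤a = m≤a
      ... | inj₁ a≤m = ⊥-elim (one≢e-one (antisym one≤m m≤one))
        where
          one≤m : one ≤ m
          one≤m = ≤-resp-≡ (sym one≡a+e-one) (e+e≡e one) (+-mono-≤ a m m a≤m)

      one≤a+a : one ≤ a + a
      one≤a+a = ≤-resp-≡ (trans (+-comm m a) (sym one≡a+e-one)) refl (+-mono-≤ m a a m≤a)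

      e[a+a]≡zero : e (a + a) ≡ zero
      e[a+a]≡zero = trans (reduce (e-+ a a)) ea≡zero

      m·[a+a]≡zero : m · (a + a) ≡ zero
      m·[a+a]≡zero = begin
        m · (a + a)                      ≡⟨ sym (+-identityʳ _) ⟩
        m · (a + a) + zero               ≡⟨ cong (m · (a + a) +_) (sym (trans (·-identityʳ _) e[a+a]≡zero)) ⟩
        m · (a + a) + e (a + a) · one    ≡⟨ sym (e-· one (a + a)) ⟩
        e (one · (a + a))                ≡⟨ cong e (one-id (a + a)) ⟩
        e (a + a)                        ≡⟨ e[a+a]≡zero ⟩
        zero                             ∎

      e-one≤zero : m ≤ zero
      e-one≤zero = ≤-resp-≡ (·-identityʳ m) m·[a+a]≡zero (·-mono-e one one (a + a) m≤one one≤a+a)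

      zero≤e-one : zero ≤ m
      zero≤e-one = proj₁ (e-absorb-≤ one zero (zero-id m))

  u-idempotent : ∀ x → x ≢ e x → u x · u x ≡ u x
  u-idempotent x x≢ex = u-least x x≢ex (u x) (u-neutral x x≢ex)

  u≢e-u : ∀ x → x ≢ e x → u x ≢ e (u x)
  u≢e-u x x≢ex ux≡e-ux = x≢ex (≡magnitude⇒≡e x≡e-ux·x (e·-isMagnitude (u x) x))
    where
      x≡e-ux·x : x ≡ e (u x) · x
      x≡e-ux·x = trans (sym (u-neutral x x≢ex)) (trans (cong (x ·_) ux≡e-ux) (·-comm x (e (u x))))

  module Idempotent (t : Carrier) (t·t≡t : t · t ≡ t) (t≢et : t ≢ e t) where
    N : Carrier
    N = e t

    N-isMagnitude : IsMagnitude N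
    N-isMagnitude = e-isMagnitude t

    N+N≡N : N + N ≡ N
    N+N≡N = magnitude⇒+-idem N-isMagnitude

    N·t≡N : N · t ≡ N
    N·t≡N = idempotent⇒e·≡e t t·t≡t

    N≤t : N ≤ t
    N≤t = idempotent⇒e≤ t t·t≡t t≢et

    t≰N : ¬ t ≤ N
    t≰N t≤N = t≢et (antisym t≤N N≤t)

    d g q : Carrier
    d = one + (- t)
    g = - d
    q = t + g

    positive : ∀ {y} → e y ≡ N → N ≤ y → y ≢ N → e y < y
    positive ey≡N N≤y y≢N = subst (_≤ _) (sym ey≡N) N≤y , λ ey≡y → y≢N (trans (sym ey≡y) ey≡N)

    t+d≡one+N : t + d ≡ one + N
    t+d≡one+N = begin
      t + (one + (- t))   ≡⟨ +-comm t (one + (- t)) ⟩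
      one + (- t) + t     ≡⟨ +-assoc one (- t) t ⟩
      one + ((- t) + t)   ≡⟨ cong (one +_) (trans (+-comm (- t) t) (neg-inv t)) ⟩
      one + N             ∎

    d+N≡d : d + N ≡ d
    d+N≡d = trans (+-assoc one (- t) N) (cong (one +_) (neg+e≡neg t))

    N·one+N≡N : N · one + N ≡ N
    N·one+N≡N = trans (cong (_+ N) (·-identityʳ N)) N+N≡N

    N·t+N≡N : N · t + N ≡ N
    N·t+N≡N = trans (cong (_+ N) N·t≡N) N+N≡N

    t·d+N≡N : t · d + N ≡ N
    t·d+N≡N = begin
      t · d + N                     ≡⟨ sym (distrib-absorbed t one (- t) N·one+N≡N N·[-t]+N≡N) ⟩
      t · one + t · (- t) + N       ≡⟨ cong (_+ N) t·one+t·[-t]≡N ⟩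
      N + N                         ≡⟨ N+N≡N ⟩
      N                             ∎
      where
        N·[-t]≡N : N · (- t) ≡ N
        N·[-t]≡N = begin
          N · (- t)   ≡⟨ sym (neg-distribʳ-· N t) ⟩
          - (N · t)   ≡⟨ cong -_ N·t≡N ⟩
          - N         ≡⟨ neg-magnitude N-isMagnitude ⟩
          N           ∎
        N·[-t]+N≡N : N · (- t) + N ≡ N
        N·[-t]+N≡N = trans (cong (_+ N) N·[-t]≡N) N+N≡N
        t·one+t·[-t]≡N : t · one + t · (- t) ≡ N
        t·one+t·[-t]≡N = trans (cong₂ _+_ (·-identityʳ t) (trans (sym (neg-distribʳ-· t t)) (cong -_ t·t≡t)))
                               (neg-inv t)

    e-d≡N : e d ≡ N
    e-d≡N = [ e-d≡e-one⇒e-d≡N , (λ e-d≡e[-t] → trans e-d≡e[-t] (neg-e t)) ]′ (e-+ one (- t))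
      where
        e-d≡e-one⇒e-d≡N : e d ≡ e one → e d ≡ N
        e-d≡e-one⇒e-d≡N e-d≡e-one = begin
          e d       ≡⟨ sym (e-least d N d+N≡d) ⟩
          e d + N   ≡⟨ cong (_+ N) (trans e-d≡e-one (e-one≡zero (one≢e-one t t≢et))) ⟩
          zero + N  ≡⟨ zero-id N ⟩
          N         ∎

    e≡N⇒e·-absorbed : ∀ {y} → e y ≡ N → ∀ z → N · z + N ≡ N → e y · z + N ≡ N
    e≡N⇒e·-absorbed ey≡N z = subst (λ w → w · z + N ≡ N) (sym ey≡N)

    d·t+N≡N : d · t + N ≡ N
    d·t+N≡N = trans (cong (_+ N) (·-comm d t)) t·d+N≡N

    N·d+N≡N : N · d + N ≡ N
    N·d+N≡N = begin
      N · d + N             ≡⟨ cong (N · d +_) (sym N+N≡N) ⟩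
      N · d + (N + N)       ≡⟨ sym (+-assoc (N · d) N N) ⟩
      N · d + N + N         ≡⟨ cong (_+ N) (+-comm (N · d) N) ⟩
      N + N · d + N         ≡⟨ cong (_+ N) (sym e[d·t]≡N+N·d) ⟩
      e (d · t) + N         ≡⟨ absorbed⇒e-absorbed (d · t) N-isMagnitude d·t+N≡N ⟩
      N                     ∎
      where
        e[d·t]≡N+N·d : e (d · t) ≡ N + N · d
        e[d·t]≡N+N·d = trans (e-· d t) (cong (_+ N · d) (trans (cong (_· t) e-d≡N) N·t≡N))

    N·N+N≡N : N · N + N ≡ N
    N·N+N≡N = begin
      N · N + N       ≡⟨ cong (N · N +_) (sym N·t≡N) ⟩
      N · N + N · t   ≡⟨ cong (λ z → N · N + z · t) (sym N-isMagnitude) ⟩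
      N · N + e N · t ≡⟨ sym (e-· t N) ⟩
      e (t · N)       ≡⟨ cong e (trans (·-comm t N) N·t≡N) ⟩
      e N             ≡⟨ N-isMagnitude ⟩
      N               ∎

    d·[one+N]+N≡d : d · (one + N) + N ≡ d
    d·[one+N]+N≡d = begin
      d · (one + N) + N     ≡⟨ sym (distrib-absorbed d one N (e≡N⇒e·-absorbed e-d≡N one N·one+N≡N)
                                                          (e≡N⇒e·-absorbed e-d≡N N N·N+N≡N)) ⟩
      d · one + d · N + N   ≡⟨ cong (λ z → d · one + z + N) (·-comm d N) ⟩
      d · one + N · d + N   ≡⟨ +-absorbed (d · one) (N · d) N·d+N≡N ⟩
      d · one + N           ≡⟨ cong (_+ N) (·-identityʳ d) ⟩
      d + N                 ≡⟨ d+N≡d ⟩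
      d                     ∎

    d·d+N≡d : d · d + N ≡ d
    d·d+N≡d = begin
      d · d + N             ≡⟨ cong (d · d +_) (sym d·t+N≡N) ⟩
      d · d + (d · t + N)   ≡⟨ sym (+-assoc (d · d) (d · t) N) ⟩
      d · d + d · t + N     ≡⟨ cong (_+ N) (+-comm (d · d) (d · t)) ⟩
      d · t + d · d + N     ≡⟨ distrib-absorbed d t d (e≡N⇒e·-absorbed e-d≡N t N·t+N≡N)
                                                      (e≡N⇒e·-absorbed e-d≡N d N·d+N≡N) ⟩
      d · (t + d) + N       ≡⟨ cong (λ z → d · z + N) t+d≡one+N ⟩
      d · (one + N) + N     ≡⟨ d·[one+N]+N≡d ⟩
      d                     ∎

    e-g≡N : e g ≡ N
    e-g≡N = trans (neg-e d) e-d≡N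

    d+g≡N : d + g ≡ N
    d+g≡N = trans (neg-inv d) e-d≡N

    g+N≡g : g + N ≡ g
    g+N≡g = trans (cong (g +_) (sym e-g≡N)) (e-neutral g)

    e-q≡N : e q ≡ N
    e-q≡N = [ (λ h → h) , (λ e-q≡e-g → trans e-q≡e-g e-g≡N) ]′ (e-+ t g)

    g·t+N≡N : g · t + N ≡ N
    g·t+N≡N = trans (cong (_+ N) (sym (neg-· d t))) (absorbed⇒neg-absorbed (d · t) N-isMagnitude d·t+N≡N)

    N·g+N≡N : N · g + N ≡ N
    N·g+N≡N = trans (cong (_+ N) (sym (neg-distribʳ-· N d)))
                    (absorbed⇒neg-absorbed (N · d) N-isMagnitude N·d+N≡N)

    q·N+N≡N : q · N + N ≡ N
    q·N+N≡N = begin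
      q · N + N             ≡⟨ cong (_+ N) (·-comm q N) ⟩
      N · (t + g) + N       ≡⟨ sym (distrib-absorbed N t g (e≡N⇒e·-absorbed N-isMagnitude t N·t+N≡N)
                                                         (e≡N⇒e·-absorbed N-isMagnitude g N·g+N≡N)) ⟩
      N · t + N · g + N     ≡⟨ +-absorbed (N · t) (N · g) N·g+N≡N ⟩
      N · t + N             ≡⟨ N·t+N≡N ⟩
      N                     ∎

    q·+N≡·g+N : ∀ y → e y ≡ N → y · t + N ≡ N → q · y + N ≡ y · g + N
    q·+N≡·g+N y ey≡N y·t+N≡N = begin
      q · y + N             ≡⟨ cong (_+ N) (trans (·-comm q y) (cong (y ·_) (+-comm t g))) ⟩
      y · (g + t) + N       ≡⟨ sym (distrib-absorbed y g t (e≡N⇒e·-absorbed ey≡N g N·g+N≡N)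
                                                         (e≡N⇒e·-absorbed ey≡N t N·t+N≡N)) ⟩
      y · g + y · t + N     ≡⟨ +-absorbed (y · g) (y · t) y·t+N≡N ⟩
      y · g + N             ∎

    N≤q·+N : N ≤ q → q ≢ N → ∀ {y} → N ≤ y → N ≤ q · y + N
    N≤q·+N N≤q q≢N {y} N≤y =
      ≤-resp-≡ q·N+N≡N refl
        (+-mono-≤ (q · N) (q · y) N (·-mono-pos q N y (positive e-q≡N N≤q q≢N) N≤y))

    d≤N⇒N≤d : d ≤ N → N ≤ d
    d≤N⇒N≤d d≤N = ≤-resp-≡ refl q·g+N≡d (N≤q·+N N≤q q≢N N≤g)
      where
        N≤g : N ≤ g
        N≤g = ≤-resp-≡ d+g≡N (trans (+-comm N g) g+N≡g) (+-mono-≤ d N g d≤N)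

        t≤q : t ≤ q
        t≤q = ≤-resp-≡ (trans (+-comm N t) (e-neutral t)) (+-comm g t) (+-mono-≤ N g t N≤g)

        N≤q : N ≤ q
        N≤q = ≤-trans N≤t t≤q

        q≢N : q ≢ N
        q≢N q≡N = t≰N (subst (t ≤_) q≡N t≤q)

        q·g+N≡d : q · g + N ≡ d
        q·g+N≡d = begin
          q · g + N   ≡⟨ q·+N≡·g+N g e-g≡N g·t+N≡N ⟩
          g · g + N   ≡⟨ cong (_+ N) (neg-·-neg d d) ⟩
          d · d + N   ≡⟨ d·d+N≡d ⟩
          d           ∎

    t≰d : ¬ t ≤ d
    t≰d t≤d = t≰N (≤-trans t≤t·d t·d≤N)
      where
        t≤t·d : t ≤ t · d
        t≤t·d = subst (_≤ t · d) t·t≡t (·-mono-pos t t d (positive refl N≤t t≢et) t≤d)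

        t·d≤N : t · d ≤ N
        t·d≤N = proj₁ (e-absorb-≤ t (t · d) t·d+N≡N)

    d≤t⇒d≤N : d ≤ t → N ≤ d → d ≤ N
    d≤t⇒d≤N d≤t N≤d = ≤-resp-≡ (trans (+-comm N (d · d)) d·d+N≡d) -[d·d]+N+d·d≡N
                               (+-mono-≤ N ((- (d · d)) + N) (d · d) N≤-[d·d]+N)
      where
        N≤q : N ≤ q
        N≤q = ≤-resp-≡ d+g≡N refl (+-mono-≤ d t g d≤t)

        q≡N⇒d≡t : q ≡ N → d ≡ t
        q≡N⇒d≡t q≡N = begin
          d             ≡⟨ sym d+N≡d ⟩
          d + N         ≡⟨ cong (d +_) (sym q≡N) ⟩
          d + (t + g)   ≡⟨ sym (+-assoc d t g) ⟩
          d + t + g     ≡⟨ cong (_+ g) (+-comm d t) ⟩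
          t + d + g     ≡⟨ +-assoc t d g ⟩
          t + (d + g)   ≡⟨ cong (t +_) d+g≡N ⟩
          t + N         ≡⟨ e-neutral t ⟩
          t             ∎

        q≢N : q ≢ N
        q≢N q≡N = t≢et (begin
          t             ≡⟨ sym (e-neutral t) ⟩
          t + N         ≡⟨ cong (_+ N) (sym t·t≡t) ⟩
          t · t + N     ≡⟨ cong (λ z → t · z + N) (sym (q≡N⇒d≡t q≡N)) ⟩
          t · d + N     ≡⟨ t·d+N≡N ⟩
          N             ∎)

        N≤-[d·d]+N : N ≤ (- (d · d)) + N
        N≤-[d·d]+N = ≤-resp-≡ refl
          (trans (q·+N≡·g+N d e-d≡N d·t+N≡N) (cong (_+ N) (sym (neg-distribʳ-· d d))))
          (N≤q·+N N≤q q≢N N≤d)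

        e[d·d]+N≡N : e (d · d) + N ≡ N
        e[d·d]+N≡N = trans (cong (_+ N) e[d·d]≡N·d) N·d+N≡N
          where
            e[d·d]≡N·d : e (d · d) ≡ N · d
            e[d·d]≡N·d = trans (e-· d d) (trans (magnitude⇒+-idem (e·-isMagnitude d d)) (cong (_· d) e-d≡N))

        -[d·d]+N+d·d≡N : (- (d · d)) + N + d · d ≡ N
        -[d·d]+N+d·d≡N = begin
          (- (d · d)) + N + d · d     ≡⟨ +-comm ((- (d · d)) + N) (d · d) ⟩
          d · d + ((- (d · d)) + N)   ≡⟨ sym (+-assoc (d · d) (- (d · d)) N) ⟩
          d · d + (- (d · d)) + N     ≡⟨ cong (_+ N) (neg-inv (d · d)) ⟩
          e (d · d) + N               ≡⟨ e[d·d]+N≡N ⟩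
          N                           ∎

    N≤d⇒d≤N : N ≤ d → d ≤ N
    N≤d⇒d≤N N≤d = [ (λ t≤d → ⊥-elim (t≰d t≤d)) , (λ d≤t → d≤t⇒d≤N d≤t N≤d) ]′
                    (total t d)

    d≡N : d ≡ N
    d≡N = [ (λ d≤N → antisym d≤N (d≤N⇒N≤d d≤N)) , (λ N≤d → antisym (N≤d⇒d≤N N≤d) N≤d) ]′
            (total d N)

    idempotent≡one+e : t ≡ one + e t
    idempotent≡one+e = begin
      t       ≡⟨ sym (e-neutral t) ⟩
      t + N   ≡⟨ cong (t +_) (sym d≡N) ⟩
      t + d   ≡⟨ t+d≡one+N ⟩
      one + N ∎

theorem4p13 : ∀ {c ℓ : Level} (S : Solid c ℓ) → let open Solid S in
                ∀ (x : Carrier) → x ≢ e x → u x ≡ one + e (u x)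
theorem4p13 S x x≢ex = Idempotent.idempotent≡one+e (u x) (u-idempotent x x≢ex) (u≢e-u x x≢ex)
  where open SolidProperties S
        open Solid S using (u)
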